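{- Let $p$ be a positive integer. Among all stable monomial ideals $I\triangleleft\mathbf k[x_1,x_2]$ with constant affine Hilbert polynomial $H_I=p$, with $(p,h)$ the bar list of the Bar Code of $\mathsf N(I)$, the maximal value that $h$ can assume is $\left\lfloor \frac{ -1+\sqrt{1+8p}}{2}\right\rfloor$.
   Context: $\mathbf k$ is a field of characteristic $0$, $x_1<x_2$, lexicographic order on terms. A monomial ideal $J$ is stable if for every term $\tau\in J$ and every variable $x_j>\min(\tau)$ (the smallest variable dividing $\tau$), $x_j\tau/\min(\tau)\in J$. The affine Hilbert function of $I$ is $d\mapsto\dim_{\mathbf k}\mathcal P(d)/I(d)$ where $\mathcal P(d)$ is the space of polynomials of degree $\le d$ and $I(d)=I\cap\mathcal P(d)$; the affine Hilbert polynomial is the polynomial agreeing with it for large $d$ (for a monomial ideal with finitely many terms outside it, it is the constant $|\mathsf N(I)|$, where $\mathsf N(I)$ is the set of terms not in $I$). For a finite set $M$ of terms, its bar list is $(\mu(1),\mu(2))$ where $\mu(1)=|M|$ and $\mu(2)$ is the number of distinct values of $\deg_{x_2}$ on $M$ (the number of $2$-bars of its Bar Code). -}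

module Defs where

open import Data.Nat using (ℕ; zero; suc; _+_; _*_; _∸_; _≤_; _≤ᵇ_)
open import Data.Nat.DivMod using (_/_)
open import Data.Bool using (Bool; true; false; if_then_else_)
open import Data.Product using (Σ; ∃; _×_; _,_)
open import Data.List using (List; length)
open import Data.List.Membership.Propositional using (_∈_)
open import Data.List.Relation.Unary.Unique.Propositional using (Unique)
open import Relation.Binary.PropositionalEquality using (_≡_)
open import Function.Bundles using (_⇔_)

-- A set of terms x₁^a x₂^b of k[x₁,x₂], given by its (decidable) membership
-- predicate on exponent pairs (a , b):  T a b ≡ true  iff  x₁^a x₂^b ∈ T.
TermSet : Set
TermSet = ℕ → ℕ → Bool

IsMonomialIdeal : TermSet → Set
IsMonomialIdeal I =
  ∀ a b → I a b ≡ true → (I (suc a) b ≡ true) × (I a (suc b) ≡ true)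

-- Stability (x₁ < x₂).  For τ = x₁^a x₂^b ∈ I: if a > 0 then min(τ) = x₁ and
-- the only variable x_j > x₁ is x₂, so x₂τ/x₁ = x₁^(a-1) x₂^(b+1) ∈ I is
-- required; if a = 0 (and b > 0) then min(τ) = x₂ and there is no larger
-- variable, so nothing is required (τ = 1 has no min: vacuous).
IsStable : TermSet → Set
IsStable I = ∀ a b → I (suc a) b ≡ true → I a (suc b) ≡ true

countOutside≤ : (ℕ → Bool) → ℕ → ℕ
countOutside≤ f zero    = if f zero then 0 else 1
countOutside≤ f (suc n) = countOutside≤ f n + (if f (suc n) then 0 else 1)

outsideOfDegree : TermSet → ℕ → ℕ
outsideOfDegree I d = countOutside≤ (λ a → I a (d ∸ a)) d

-- affine Hilbert function of (the ideal generated by) the monomial ideal I: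
-- dim P(d)/I(d) = number of terms of degree ≤ d not in I.
affineHF : TermSet → ℕ → ℕ
affineHF I zero    = outsideOfDegree I zero
affineHF I (suc d) = affineHF I d + outsideOfDegree I (suc d)

HilbertPolyConst : TermSet → ℕ → Set
HilbertPolyConst I p = ∃ λ d₀ → ∀ d → d₀ ≤ d → affineHF I d ≡ p

-- h is the number of distinct values of deg_{x₂} on N(I) (the number of
-- 2-bars of the Bar Code of N(I)): there is a duplicate-free list of
-- exactly those values, of length h.
NumX2Degrees : TermSet → ℕ → Set
NumX2Degrees I h =
  Σ (List ℕ) λ L → Unique L × (∀ b → (b ∈ L) ⇔ (∃ λ a → I a b ≡ false))
                 × (length L ≡ h)

isqrt : ℕ → ℕ
isqrt zero    = zero
isqrt (suc n) with isqrt n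
... | s = if (suc s * suc s) ≤ᵇ suc n then suc s else s

-- ⌊(-1 + √(1+8p))/2⌋ ; equals ⌊(⌊√(1+8p)⌋ - 1)/2⌋ since the real function
-- y ↦ (y-1)/2 only crosses integers at integer y.
maxBars : ℕ → ℕ
maxBars p = (isqrt (1 + 8 * p) ∸ 1) / 2

-- In a stable ideal, x₁^a x₂^c ∈ I forces x₂^(a+c) ∈ I.  If N(I) has h distinct x₂-degrees, one
-- of them is ≥ h - 1, so x₂^(h-1) ∉ I, and then every term of degree < h lies in N(I).  These are
-- h(h+1)/2 terms and the affine Hilbert function is increasing, so h(h+1)/2 ≤ p, which says
-- h ≤ ⌊(-1 + √(1+8p))/2⌋.  For the largest such h, the complement of the terms of degree < h and
-- of the p - h(h+1)/2 powers x₁^h, x₁^(h+1), … is a stable ideal attaining the bound.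
module Submission where

open import Defs
open import Data.Nat using (ℕ; suc; _≤_)
open import Data.Product using (Σ; _×_)

open import Data.Bool using (Bool; true; false; if_then_else_)
open import Data.Bool.Properties using (T-≡; not-¬; ¬-not)
open import Data.Fin using (Fin; fromℕ<; zero; suc)
open import Data.Fin.Properties using (injective⇒≤; fromℕ<-injective)
open import Data.List using (List; _∷_; length; lookup; upTo)
open import Data.List.Properties using (length-upTo)
open import Data.List.Membership.Propositional using (_∈_; find)
open import Data.List.Membership.Propositional.Properties using (∈-lookup; ∈-upTo⁺; ∈-upTo⁻)
open import Data.List.Relation.Unary.All as All using (All; all?)
open import Data.List.Relation.Unary.All.Properties using (¬All⇒Any¬)
open import Data.List.Relation.Unary.AllPairs using (_∷_)
open import Data.List.Relation.Unary.Unique.Propositional using (Unique)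
open import Data.List.Relation.Unary.Unique.Propositional.Properties using (upTo⁺)
open import Data.Nat
  using (zero; NonZero; _+_; _*_; _∸_; _<_; _≤′_; _≤ᵇ_; z≤n; s≤s; s≤s⁻¹; ≤′-refl; ≤′-step; _<?_)
open import Data.Nat.DivMod using (_/_; m/n*n≤m; m*n/n≡m; /-monoˡ-≤)
open import Data.Nat.Properties
open import Data.Nat.Tactic.RingSolver using (solve-∀)
open import Data.Product using (∃; _,_; proj₁; proj₂)
open import Function using (_∘_)
open import Function.Bundles using (_⇔_; mk⇔; Equivalence)
open import Function.Related.Propositional using (module EquationalReasoning)
open import Relation.Binary.PropositionalEquality
open import Relation.Nullary using (yes; no; contradiction)

private
  variable
    I : TermSet
    a b c d e i m n p h v : ℕ

open Equivalence using (to; from)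

contraposeᵇ : {x y : Bool} → (x ≡ true → y ≡ true) → y ≡ false → x ≡ false
contraposeᵇ f y≡false = ¬-not (λ x≡true → not-¬ (f x≡true) y≡false)

≤ᵇ≡true⇒≤ : (m ≤ᵇ n) ≡ true → m ≤ n
≤ᵇ≡true⇒≤ {m} {n} = ≤ᵇ⇒≤ m n ∘ from T-≡

≤⇒≤ᵇ≡true : m ≤ n → (m ≤ᵇ n) ≡ true
≤⇒≤ᵇ≡true = to T-≡ ∘ ≤⇒≤ᵇ

≤ᵇ≡false⇒> : (m ≤ᵇ n) ≡ false → n < m
≤ᵇ≡false⇒> m≰ᵇn = ≰⇒> (λ m≤n → not-¬ (≤⇒≤ᵇ≡true m≤n) m≰ᵇn)

>⇒≤ᵇ≡false : n < m → (m ≤ᵇ n) ≡ false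
>⇒≤ᵇ≡false n<m = ¬-not (<⇒≱ n<m ∘ ≤ᵇ≡true⇒≤)

lookup-injective : {xs : List ℕ} → Unique xs → ∀ i j → lookup xs i ≡ lookup xs j → i ≡ j
lookup-injective (_ ∷ _)      zero    zero    _  = refl
lookup-injective (x∉xs ∷ _)   zero    (suc j) eq = contradiction eq (All.lookup x∉xs (∈-lookup j))
lookup-injective (x∉xs ∷ _)   (suc i) zero    eq = contradiction (sym eq) (All.lookup x∉xs (∈-lookup i))
lookup-injective (_ ∷ unique) (suc i) (suc j) eq = cong suc (lookup-injective unique i j eq)

unique-bounded⇒length≤ : {xs : List ℕ} → Unique xs → All (_< n) xs → length xs ≤ n
unique-bounded⇒length≤ {n = n} {xs = xs} unique bounded = injective⇒≤ {f = index} index-injective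
  where
  index : Fin (length xs) → Fin n
  index i = fromℕ< (All.lookup bounded (∈-lookup i))

  index-injective : ∀ {i j} → index i ≡ index j → i ≡ j
  index-injective = lookup-injective unique _ _ ∘ fromℕ<-injective _ _ _ _

unique-length⇒large-element : {xs : List ℕ} → Unique xs → length xs ≡ suc n → ∃ λ b → b ∈ xs × n ≤ b
unique-length⇒large-element {n} {xs} unique len with all? (_<? n) xs
... | yes bounded = contradiction (subst (_≤ n) len (unique-bounded⇒length≤ unique bounded)) 1+n≰n
... | no unbounded =
  let b , b∈xs , b≮n = find (¬All⇒Any¬ (_<? n) xs unbounded) in b , b∈xs , ≮⇒≥ b≮n

tri : ℕ → ℕ
tri zero    = 0
tri (suc n) = tri n + suc n

odd²≡1+8*tri : ∀ n → (n * 2 + 1) * (n * 2 + 1) ≡ 1 + 8 * tri n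
odd²≡1+8*tri zero    = refl
odd²≡1+8*tri (suc n) = begin
  (suc n * 2 + 1) * (suc n * 2 + 1)        ≡⟨ expand n ⟩
  (n * 2 + 1) * (n * 2 + 1) + 8 * suc n    ≡⟨ cong (_+ 8 * suc n) (odd²≡1+8*tri n) ⟩
  1 + 8 * tri n + 8 * suc n                ≡⟨ collect (tri n) n ⟩
  1 + 8 * (tri n + suc n)                  ∎
  where
  open ≡-Reasoning
  expand : ∀ n → (suc n * 2 + 1) * (suc n * 2 + 1) ≡ (n * 2 + 1) * (n * 2 + 1) + 8 * suc n
  expand = solve-∀
  collect : ∀ t n → 1 + 8 * t + 8 * suc n ≡ 1 + 8 * (t + suc n)
  collect = solve-∀

isqrt-bounds : ∀ n → isqrt n * isqrt n ≤ n × n < suc (isqrt n) * suc (isqrt n)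
isqrt-bounds zero = z≤n , s≤s z≤n
isqrt-bounds (suc n) with isqrt n | isqrt-bounds n
... | s | s²≤n , n<[1+s]² with suc s * suc s ≤ᵇ suc n in [1+s]²≤ᵇ1+n
...   | true  = ≤ᵇ≡true⇒≤ [1+s]²≤ᵇ1+n ,
                ≤-<-trans n<[1+s]² (*-mono-< (n<1+n (suc s)) (n<1+n (suc s)))
...   | false = m≤n⇒m≤1+n s²≤n , ≤ᵇ≡false⇒> [1+s]²≤ᵇ1+n

≤isqrt⇔square≤ : ∀ n → m ≤ isqrt n ⇔ m * m ≤ n
≤isqrt⇔square≤ n = mk⇔
  (λ m≤s → ≤-trans (*-mono-≤ m≤s m≤s) s²≤n)
  (λ m²≤n → ≮⇒≥ (λ s<m → <⇒≱ n<[1+s]² (≤-trans (*-mono-≤ s<m s<m) m²≤n)))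
  where
  s²≤n : isqrt n * isqrt n ≤ n
  s²≤n = proj₁ (isqrt-bounds n)
  n<[1+s]² : n < suc (isqrt n) * suc (isqrt n)
  n<[1+s]² = proj₂ (isqrt-bounds n)

≤/⇔*≤ : ∀ {m n} o .{{_ : NonZero o}} → m ≤ n / o ⇔ m * o ≤ n
≤/⇔*≤ {m} {n} o = mk⇔
  (λ m≤n/o → ≤-trans (*-monoˡ-≤ o m≤n/o) (m/n*n≤m n o))
  (λ m*o≤n → subst (_≤ n / o) (m*n/n≡m m o) (/-monoˡ-≤ o m*o≤n))

≤maxBars⇔tri≤ : h ≤ maxBars p ⇔ tri h ≤ p
≤maxBars⇔tri≤ {h} {p} = begin
  h ≤ (s ∸ 1) / 2                               ∼⟨ ≤/⇔*≤ 2 ⟩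
  h * 2 ≤ s ∸ 1                                 ∼⟨ mk⇔ (m≤o∸n⇒m+n≤o _ 1≤s) (m+n≤o⇒m≤o∸n _) ⟩
  h * 2 + 1 ≤ s                                 ∼⟨ ≤isqrt⇔square≤ (1 + 8 * p) ⟩
  (h * 2 + 1) * (h * 2 + 1) ≤ 1 + 8 * p         ≡⟨ cong (_≤ 1 + 8 * p) (odd²≡1+8*tri h) ⟩
  1 + 8 * tri h ≤ 1 + 8 * p                     ∼⟨ mk⇔ (*-cancelˡ-≤ 8 ∘ s≤s⁻¹) (s≤s ∘ *-monoʳ-≤ 8) ⟩
  tri h ≤ p                                     ∎
  where
  open EquationalReasoning
  s : ℕ
  s = isqrt (1 + 8 * p)
  1≤s : 1 ≤ s
  1≤s = from (≤isqrt⇔square≤ (1 + 8 * p)) (s≤s z≤n)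

countOutside≤-all-false : {f : ℕ → Bool} → (∀ a → a ≤ n → f a ≡ false) → countOutside≤ f n ≡ suc n
countOutside≤-all-false {zero}  outside rewrite outside 0 z≤n = refl
countOutside≤-all-false {suc n} outside
  rewrite countOutside≤-all-false (λ a a≤n → outside a (m≤n⇒m≤1+n a≤n)) | outside (suc n) ≤-refl
  = +-comm (suc n) 1

countOutside≤-all-true : {f : ℕ → Bool} → (∀ a → a ≤ n → f a ≡ true) → countOutside≤ f n ≡ 0
countOutside≤-all-true {zero}  inside rewrite inside 0 z≤n = refl
countOutside≤-all-true {suc n} inside
  rewrite countOutside≤-all-true (λ a a≤n → inside a (m≤n⇒m≤1+n a≤n)) | inside (suc n) ≤-refl
  = refl

outsideOfDegree-all-outside : (∀ a c → a + c ≡ d → I a c ≡ false) → outsideOfDegree I d ≡ suc d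
outsideOfDegree-all-outside outside =
  countOutside≤-all-false (λ a a≤d → outside a _ (m+[n∸m]≡n a≤d))

outsideOfDegree-off-x₁-axis-inside :
  (∀ a c → a + suc c ≡ d → I a (suc c) ≡ true) → outsideOfDegree I d ≡ (if I d 0 then 0 else 1)
outsideOfDegree-off-x₁-axis-inside {d = zero}  _ = refl
outsideOfDegree-off-x₁-axis-inside {d = suc d} {I} inside
  = cong₂ _+_ (countOutside≤-all-true inside-below)
              (cong (λ c → if I (suc d) c then 0 else 1) (n∸n≡0 d))
  where
  inside-below : ∀ a → a ≤ d → I a (suc d ∸ a) ≡ true
  inside-below a a≤d rewrite +-∸-assoc 1 a≤d =
    inside a (d ∸ a) (trans (+-suc a (d ∸ a)) (cong suc (m+[n∸m]≡n a≤d)))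

affineHF-all-outside : (∀ a c → a + c ≤ d → I a c ≡ false) → affineHF I d ≡ tri (suc d)
affineHF-all-outside {zero}  outside =
  outsideOfDegree-all-outside (λ a c → outside a c ∘ ≤-reflexive)
affineHF-all-outside {suc d} outside = cong₂ _+_
  (affineHF-all-outside (λ a c → outside a c ∘ m≤n⇒m≤1+n))
  (outsideOfDegree-all-outside (λ a c → outside a c ∘ ≤-reflexive))

affineHF-mono : d ≤ n → affineHF I d ≤ affineHF I n
affineHF-mono = mono′ ∘ ≤⇒≤′
  where
  mono′ : d ≤′ n → affineHF I d ≤ affineHF I n
  mono′ ≤′-refl         = ≤-refl
  mono′ (≤′-step d≤′n) = ≤-trans (mono′ d≤′n) (m≤m+n _ _)

affineHF≤HilbertPoly : HilbertPolyConst I p → ∀ d → affineHF I d ≤ p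
affineHF≤HilbertPoly (d₀ , const) d =
  ≤-trans (affineHF-mono (m≤m+n d d₀)) (≤-reflexive (const (d + d₀) (m≤n+m d₀ d)))

affineHF-linear : (∀ k → d < k → k ≤ d + i → outsideOfDegree I k ≡ v) →
                  affineHF I (d + i) ≡ affineHF I d + i * v
affineHF-linear {d} {zero} {I} _ = trans (cong (affineHF I) (+-identityʳ d)) (sym (+-identityʳ _))
affineHF-linear {d} {suc i} {I} {v} degree-k = begin
  affineHF I (d + suc i)                               ≡⟨ cong (affineHF I) (+-suc d i) ⟩
  affineHF I (d + i) + outsideOfDegree I (suc (d + i))  ≡⟨ cong₂ _+_ (affineHF-linear earlier) last ⟩
  affineHF I d + i * v + v                             ≡⟨ +-assoc (affineHF I d) (i * v) v ⟩
  affineHF I d + (i * v + v)                           ≡⟨ cong (affineHF I d +_) (+-comm (i * v) v) ⟩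
  affineHF I d + suc i * v                             ∎
  where
  open ≡-Reasoning
  earlier : ∀ k → d < k → k ≤ d + i → outsideOfDegree I k ≡ v
  earlier k d<k k≤d+i = degree-k k d<k (≤-trans k≤d+i (+-monoʳ-≤ d (n≤1+n i)))
  last : outsideOfDegree I (suc (d + i)) ≡ v
  last = degree-k _ (s≤s (m≤m+n d i)) (≤-reflexive (sym (+-suc d i)))

HilbertPolyConst-affineHF : (∀ k → d < k → outsideOfDegree I k ≡ 0) →
                            HilbertPolyConst I (affineHF I d)
HilbertPolyConst-affineHF {d} {I} none-above = d , constant
  where
  constant : ∀ n → d ≤ n → affineHF I n ≡ affineHF I d
  constant n d≤n with i , refl ← m≤n⇒∃[o]m+o≡n d≤n = begin
    affineHF I (d + i)      ≡⟨ affineHF-linear (λ k d<k _ → none-above k d<k) ⟩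
    affineHF I d + i * 0    ≡⟨ cong (affineHF I d +_) (*-zeroʳ i) ⟩
    affineHF I d + 0        ≡⟨ +-identityʳ _ ⟩
    affineHF I d            ∎
    where open ≡-Reasoning

inside-upward : IsMonomialIdeal I → a ≤ c → b ≤ d → I a b ≡ true → I c d ≡ true
inside-upward {I = I} {a = a} {b = b} ideal a≤c b≤d = upward′ (≤⇒≤′ a≤c) (≤⇒≤′ b≤d)
  where
  upward′ : ∀ {c d} → a ≤′ c → b ≤′ d → I a b ≡ true → I c d ≡ true
  upward′ ≤′-refl          ≤′-refl          inside = inside
  upward′ (≤′-step a≤′c)  b≤′d             inside = proj₁ (ideal _ _ (upward′ a≤′c b≤′d inside))
  upward′ ≤′-refl          (≤′-step b≤′d)  inside = proj₂ (ideal _ _ (upward′ ≤′-refl b≤′d inside))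

outside-downward : IsMonomialIdeal I → a ≤ c → b ≤ d → I c d ≡ false → I a b ≡ false
outside-downward ideal a≤c b≤d = contraposeᵇ (inside-upward ideal a≤c b≤d)

stable⇒x₂^degree-inside : IsStable I → I a c ≡ true → I 0 (a + c) ≡ true
stable⇒x₂^degree-inside {a = zero}          _      inside = inside
stable⇒x₂^degree-inside {I} {a = suc a} {c} stable inside =
  subst (λ k → I 0 k ≡ true) (+-suc a c) (stable⇒x₂^degree-inside {I} stable (stable a c inside))

x₂^d-outside⇒degree≤d-outside : IsMonomialIdeal I → IsStable I → I 0 d ≡ false →
                                 ∀ a c → a + c ≤ d → I a c ≡ false
x₂^d-outside⇒degree≤d-outside {I} ideal stable x₂^d-outside a c a+c≤d =
  contraposeᵇ (stable⇒x₂^degree-inside {I} stable) (outside-downward ideal z≤n a+c≤d x₂^d-outside)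

x₂-degrees≤maxBars : IsMonomialIdeal I → IsStable I → HilbertPolyConst I p →
                     NumX2Degrees I h → h ≤ maxBars p
x₂-degrees≤maxBars {h = zero} _ _ _ _ = z≤n
x₂-degrees≤maxBars {I} {p} {suc h} ideal stable hp (L , unique , L↔ , length≡)
  with b , b∈L , h≤b ← unique-length⇒large-element unique length≡
  with a , outside ← to (L↔ b) b∈L
  = from ≤maxBars⇔tri≤ (begin
    tri (suc h)   ≡⟨ affineHF-all-outside degree≤h-outside ⟨
    affineHF I h  ≤⟨ affineHF≤HilbertPoly hp h ⟩
    p             ∎)
  where
  open ≤-Reasoning
  degree≤h-outside : ∀ a c → a + c ≤ h → I a c ≡ false
  degree≤h-outside =
    x₂^d-outside⇒degree≤d-outside ideal stable (outside-downward ideal z≤n h≤b outside)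

-- N(staircase m e) consists of the terms of degree < m and the powers x₁^a with m ≤ a < m + e.
staircase : ℕ → ℕ → TermSet
staircase m e a zero    = m + e ≤ᵇ a
staircase m e a (suc b) = m ≤ᵇ a + suc b

staircase-ideal : IsMonomialIdeal (staircase m e)
staircase-ideal {m} {e} a zero inside =
  let m+e≤a = ≤ᵇ≡true⇒≤ inside in
  ≤⇒≤ᵇ≡true (m≤n⇒m≤1+n m+e≤a) ,
  ≤⇒≤ᵇ≡true (≤-trans (m≤m+n m e) (≤-trans m+e≤a (m≤m+n a 1)))
staircase-ideal {m} a (suc b) inside =
  let m≤a+1+b = ≤ᵇ≡true⇒≤ inside in
  ≤⇒≤ᵇ≡true {m} (m≤n⇒m≤1+n m≤a+1+b) ,
  ≤⇒≤ᵇ≡true {m} (≤-trans m≤a+1+b (+-monoʳ-≤ a (n≤1+n (suc b))))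

staircase-stable : IsStable (staircase m e)
staircase-stable {m} {e} a zero inside =
  ≤⇒≤ᵇ≡true (≤-trans (m≤m+n m e) (≤-trans (≤ᵇ≡true⇒≤ inside) (≤-reflexive (+-comm 1 a))))
staircase-stable {m} a (suc b) inside =
  ≤⇒≤ᵇ≡true {m} (≤-trans (≤ᵇ≡true⇒≤ inside) (≤-reflexive (sym (+-suc a (suc b)))))

staircase-degree<m-outside : a + c < m → staircase m e a c ≡ false
staircase-degree<m-outside {a} {zero} {m} {e} a+0<m =
  >⇒≤ᵇ≡false (<-≤-trans (≤-<-trans (m≤m+n a 0) a+0<m) (m≤m+n m e))
staircase-degree<m-outside {c = suc c} a+c<m = >⇒≤ᵇ≡false a+c<m

staircase-outsideOfDegree : m ≤ d →
                            outsideOfDegree (staircase m e) d ≡ (if m + e ≤ᵇ d then 0 else 1)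
staircase-outsideOfDegree {m} {e = e} m≤d = outsideOfDegree-off-x₁-axis-inside {I = staircase m e}
  (λ a c a+c≡d → ≤⇒≤ᵇ≡true (≤-trans m≤d (≤-reflexive (sym a+c≡d))))

staircase-affineHF : affineHF (staircase (suc m) e) (m + e) ≡ tri (suc m) + e
staircase-affineHF {m} {e} = begin
  affineHF S (m + e)    ≡⟨ affineHF-linear {I = S} x₁-power-outside ⟩
  affineHF S m + e * 1  ≡⟨ cong₂ _+_ (affineHF-all-outside degree≤m-outside) (*-identityʳ e) ⟩
  tri (suc m) + e       ∎
  where
  open ≡-Reasoning
  S : TermSet
  S = staircase (suc m) e
  degree≤m-outside : ∀ a c → a + c ≤ m → S a c ≡ false
  degree≤m-outside a c = staircase-degree<m-outside {a} {c} ∘ s≤s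
  x₁-power-outside : ∀ k → m < k → k ≤ m + e → outsideOfDegree S k ≡ 1
  x₁-power-outside k m<k k≤m+e = trans (staircase-outsideOfDegree m<k)
                                       (cong (if_then 0 else 1) (>⇒≤ᵇ≡false (s≤s k≤m+e)))

staircase-hilbert : HilbertPolyConst (staircase (suc m) e) (tri (suc m) + e)
staircase-hilbert {m} {e} =
  subst (HilbertPolyConst _) (staircase-affineHF {m} {e}) (HilbertPolyConst-affineHF all-inside)
  where
  all-inside : ∀ k → m + e < k → outsideOfDegree (staircase (suc m) e) k ≡ 0
  all-inside k m+e<k = trans (staircase-outsideOfDegree (≤-trans (s≤s (m≤m+n m e)) m+e<k))
                             (cong (if_then 0 else 1) (≤⇒≤ᵇ≡true m+e<k))

staircase-x₂-degrees : NumX2Degrees (staircase (suc m) e) (suc m)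
staircase-x₂-degrees {m} {e} =
  upTo (suc m) , upTo⁺ _ , (λ b → mk⇔ (outside-in-row b) (row∈ b)) , length-upTo _
  where
  outside-in-row : ∀ b → b ∈ upTo (suc m) → ∃ λ a → staircase (suc m) e a b ≡ false
  outside-in-row b b∈ = 0 , staircase-degree<m-outside {0} {b} (∈-upTo⁻ b∈)
  row∈ : ∀ b → (∃ λ a → staircase (suc m) e a b ≡ false) → b ∈ upTo (suc m)
  row∈ zero    _             = ∈-upTo⁺ (s≤s z≤n)
  row∈ (suc b) (a , outside) = ∈-upTo⁺ (≤-<-trans (m≤n+m (suc b) a) (≤ᵇ≡false⇒> outside))

staircase-extremal : 1 ≤ m → tri m ≤ p →
  let I = staircase m (p ∸ tri m) in
  IsMonomialIdeal I × IsStable I × HilbertPolyConst I p × NumX2Degrees I m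
staircase-extremal {suc m} {p} (s≤s z≤n) tri≤p =
  staircase-ideal , staircase-stable ,
  subst (HilbertPolyConst _) (m+[n∸m]≡n tri≤p) (staircase-hilbert {m} {p ∸ tri (suc m)}) ,
  staircase-x₂-degrees

mainTheorem6 :
    (p : ℕ) → 1 ≤ p →
      ((I : TermSet) → IsMonomialIdeal I → IsStable I → HilbertPolyConst I p →
         (h : ℕ) → NumX2Degrees I h → h ≤ maxBars p)
      × Σ TermSet (λ I → IsMonomialIdeal I × IsStable I × HilbertPolyConst I p
                           × NumX2Degrees I (maxBars p))
mainTheorem6 p 1≤p =
  (λ I ideal stable hp h → x₂-degrees≤maxBars ideal stable hp) ,
  (staircase (maxBars p) (p ∸ tri (maxBars p)) ,
   staircase-extremal (from ≤maxBars⇔tri≤ 1≤p) (to ≤maxBars⇔tri≤ ≤-refl))
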